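{- Let $n\ge 3$ and let $C_n$ be the cycle of order $n$. (i) If $S\in\mathcal{S}_{1,2,4,4}$, then $C_n$ is $\chi_S$-critical if and only if $n\in\{3,5,6,7,9\}$. (ii) If $S\in\mathcal{S}_{1,2,\overline{4},5}$, then $C_n$ is $\chi_S$-critical if and only if $n\in\{3,5,6,7,9,10,11,17\}$. (iii) If $S\in\mathcal{S}_{1,2,\overline{4},6}$, then $C_n$ is $\chi_S$-critical if and only if $n\in\{3,5,6,7,9,10,11,12,13,17,18,19,20,25,26,27,33,34,41\}$.
   Context: A packing sequence is a non-decreasing infinite sequence $S=(s_1,s_2,\ldots)$ of positive integers. For a graph $G$, a map $\phi\colon V(G)\to\{1,\ldots,k\}$ is an $S$-packing $k$-coloring if any two distinct vertices $u,v$ with $\phi(u)=\phi(v)=i$ satisfy $d_G(u,v) > s_i$; $\chi_S(G)$ is the least such $k$. A graph $G$ is $\chi_S$-critical if $\chi_S(H)<\chi_S(G)$ for every proper subgraph $H$ of $G$. Notation: $\mathcal{S}_{a_1,\ldots,a_m}$ is the set of packing sequences with $s_j=a_j$ for $j\le m$ (later entries arbitrary subject to being a packing sequence); $\mathcal{S}_{a_1,\ldots,a_{i-1},\overline{a_i},a_{i+1},\ldots,a_m}$ is the set of packing sequences with $s_j=a_j$ for $j\le m$, $j\ne i$, and $a_i\le s_i\le a_{i+1}$. Thus $\mathcal{S}_{1,2,4,4}$: $s_1=1,s_2=2,s_3=s_4=4$; $\mathcal{S}_{1,2,\overline{4},5}$: $s_1=1,s_2=2,4\le s_3\le5,s_4=5$;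 $\mathcal{S}_{1,2,\overline{4},6}$: $s_1=1,s_2=2,4\le s_3\le 6,s_4=6$. -}

module Defs where

open import Data.Nat using (ℕ; zero; suc; _≤_; _<_; _≡ᵇ_)
open import Data.Fin using (Fin; toℕ)
open import Data.Bool using (Bool; true; false; _∨_; _∧_)
open import Data.Product using (Σ; _×_; ∃)
open import Data.Sum using (_⊎_)
open import Relation.Binary.PropositionalEquality using (_≡_)
open import Relation.Nullary using (¬_)

-- A (finite simple) graph whose vertex set is a subset of Fin m:
-- inV v = true  iff v is a vertex, inE u v = true iff uv is an edge.
record Graph (m : ℕ) : Set where
  field
    inV : Fin m → Bool
    inE : Fin m → Fin m → Bool
open Graph public

nextOf : (n : ℕ) → Fin n → Fin n → Bool
nextOf n i j = (suc (toℕ i) ≡ᵇ toℕ j) ∨ ((suc (toℕ i) ≡ᵇ n) ∧ (toℕ j ≡ᵇ 0))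

Cycle : (n : ℕ) → Graph n
Cycle n = record { inV = λ _ → true ; inE = λ i j → nextOf n i j ∨ nextOf n j i }

-- H is a subgraph of G (H is itself a graph: edges are symmetric and
-- join vertices of H).
record IsSubgraph {m : ℕ} (H G : Graph m) : Set where
  field
    V⊆ : ∀ v → inV H v ≡ true → inV G v ≡ true
    E⊆ : ∀ u v → inE H u v ≡ true → inE G u v ≡ true
    E-sym : ∀ u v → inE H u v ≡ inE H v u
    E-ends : ∀ u v → inE H u v ≡ true → inV H u ≡ true

ProperSubgraph : {m : ℕ} → Graph m → Graph m → Set
ProperSubgraph H G =
  IsSubgraph H G ×
  ((Σ _ λ v → inV G v ≡ true × inV H v ≡ false) ⊎
   (Σ _ λ u → Σ _ λ v → inE G u v ≡ true × inE H u v ≡ false))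

data Walk {m : ℕ} (G : Graph m) : Fin m → Fin m → ℕ → Set where
  nil  : ∀ {u} → inV G u ≡ true → Walk G u u 0
  cons : ∀ {u w v ℓ} → inE G u w ≡ true → Walk G w v ℓ → Walk G u v (suc ℓ)

-- d_G(u,v) > s  (no u–v walk, hence no path, of length ≤ s)
DistGt : {m : ℕ} → Graph m → Fin m → Fin m → ℕ → Set
DistGt G u v s = ∀ ℓ → Walk G u v ℓ → s < ℓ

-- Packing sequence s_1, s_2, …  (the value s 0 is unused)
IsPackingSeq : (ℕ → ℕ) → Set
IsPackingSeq s = ∀ i → 1 ≤ i → (1 ≤ s i) × (s i ≤ s (suc i))

IsPackingColoring : {m : ℕ} → Graph m → (ℕ → ℕ) → ℕ → (Fin m → ℕ) → Set
IsPackingColoring G s k φ =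
  (∀ v → inV G v ≡ true → (1 ≤ φ v) × (φ v ≤ k)) ×
  (∀ u v → inV G u ≡ true → inV G v ≡ true → ¬ (u ≡ v) →
     φ u ≡ φ v → DistGt G u v (s (φ u)))

PackingColorable : {m : ℕ} → Graph m → (ℕ → ℕ) → ℕ → Set
PackingColorable G s k = Σ (Fin _ → ℕ) λ φ → IsPackingColoring G s k φ

IsChiS : {m : ℕ} → Graph m → (ℕ → ℕ) → ℕ → Set
IsChiS G s k = PackingColorable G s k × (∀ j → j < k → ¬ PackingColorable G s j)

IsChiSCritical : {m : ℕ} → Graph m → (ℕ → ℕ) → Set
IsChiSCritical G s = ∀ H → ProperSubgraph H G →
  ∀ a b → IsChiS H s a → IsChiS G s b → a < b

S-1-2-4-4 : (ℕ → ℕ) → Set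
S-1-2-4-4 s = (s 1 ≡ 1) × (s 2 ≡ 2) × (s 3 ≡ 4) × (s 4 ≡ 4)

S-1-2-4bar-5 : (ℕ → ℕ) → Set
S-1-2-4bar-5 s = (s 1 ≡ 1) × (s 2 ≡ 2) × (4 ≤ s 3) × (s 3 ≤ 5) × (s 4 ≡ 5)

S-1-2-4bar-6 : (ℕ → ℕ) → Set
S-1-2-4bar-6 s = (s 1 ≡ 1) × (s 2 ≡ 2) × (4 ≤ s 3) × (s 3 ≤ 6) × (s 4 ≡ 6)

-- Colorings are handled as sequences: color the positions 0, 1, 2, … of a path, or of a cycle
-- read around forever.  If no S-packing coloring of w consecutive positions uses only k colors and
-- w ≤ s_{k+1}, then no coloring of 2w positions uses k + 1 colors: color k + 1 must occur among the
-- first w positions and again within the next w.  For s = (1, 2, ≥ 4, …) this gives χ_S(P_n) = 2, 3, 4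
-- for n = 3, 4–7, ≥ 8, attained by the ruler sequence 12131214 12131214 ….  Every proper subgraph of
-- C_n lies in a path on n vertices, so C_n is critical iff it is not χ_S(P_n)-colorable.
--
-- On C_n the same argument puts the top color k + 1 in every window of w vertices, while consecutive
-- occurrences are more than s_{k+1} apart, so n is a sum of gaps in [s_{k+1} + 1, w].  This excludes
-- 2-colorings of C_n for n ≥ 3 and 3-colorings for n ≥ 5, and a 4-coloring of C_n (n > 8) cuts n into
-- parts in [s₄ + 1, 8].  Conversely the blocks 1213u4, u a prefix of 121, have lengths 5 to 8 and
-- concatenate to a 4-coloring of C_n along any such composition.  What remains is arithmetic: n has
-- a composition with parts in [a, b] iff m a ≤ n ≤ m b for some m.

module Submission where

open import Defs
open import Data.Nat using (ℕ; zero; suc; _+_; _*_; _∸_; _≤_; _<_; _⊓_; _≡ᵇ_; z≤n; s≤s; s≤s⁻¹; z<s; NonZero; ∣_-_∣)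
open import Data.Nat.Properties
open import Data.Nat.DivMod using (_%_; _/_; _mod_; m≡m%n+[m/n]*n; [m+n]%n≡m%n; [m+kn]%n≡m%n; m<n⇒m%n≡m; m%n<n; n%n≡0; m≤n⇒[n∸m]%m≡n%m)
open import Data.Nat.Induction using (<-rec)
open import Data.Nat.ListAction using (sum)
open import Data.Nat.ListAction.Properties using (sum-++)
open import Data.Bool using (true; false; _∨_; _∧_)
open import Data.Bool.Properties using (T-≡; ∨-comm)
open import Data.Fin using (Fin; toℕ; fromℕ; zero)
open import Data.Fin.Properties using (toℕ-injective; toℕ<n; toℕ-fromℕ<; toℕ-fromℕ)
open import Data.List using (List; []; _∷_; _++_; length; concat; map; replicate; take)
open import Data.List.Properties using (length-++; ++-assoc; ++-identityʳ; concat-++; map-++)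
open import Data.List.Relation.Unary.All as All using (All; []; _∷_; all?)
open import Data.List.Relation.Unary.All.Properties using (map⁺; ++⁺; concat⁺; take⁺; replicate⁺)
open import Data.List.Membership.Propositional using (_∈_)
open import Data.List.Membership.DecPropositional _≟_ using (_∈?_)
open import Data.Product using (Σ-syntax; ∃; _×_; _,_; proj₁; proj₂)
open import Data.Sum using (_⊎_; inj₁; inj₂)
open import Data.Empty using (⊥-elim)
open import Function using (_∘_; id; const)
open import Function.Bundles using (Equivalence; _⇔_; mk⇔)
open import Function.Construct.Composition using (_⇔-∘_)
open import Function.Related.TypeIsomorphisms using (¬-cong-⇔)
open import Relation.Nullary using (¬_; Dec; yes; no)
open import Relation.Nullary.Decidable using (toWitness; True; map′; ¬?; _×-dec_; _⊎-dec_; _→-dec_)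
open import Relation.Binary.Definitions using (tri<; tri≈; tri>)
open import Relation.Binary.PropositionalEquality
  using (_≡_; _≢_; refl; sym; trans; cong; cong₂; subst; subst₂; module ≡-Reasoning)

-- Sequences as colorings

-- PathPacking s N f: f is an S-packing coloring of the path
-- 0 − 1 − ⋯ − (N − 1); CyclePacking s n f: the same on C_n, whose vertices with labels d apart
-- are cycleDist n d apart.
Palette : ℕ → ℕ → (ℕ → ℕ) → Set
Palette k N f = ∀ {i} → i < N → 1 ≤ f i × f i ≤ k

record PackedBy (δ s : ℕ → ℕ) (N : ℕ) (f : ℕ → ℕ) : Set where
  constructor packedBy
  field
    separated : ∀ {j} → j < N → ∀ {i} → i < j → f i ≡ f j → s (f i) < δ (j ∸ i)
open PackedBy public

PathPacking : (ℕ → ℕ) → ℕ → (ℕ → ℕ) → Set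
PathPacking = PackedBy id

cycleDist : ℕ → ℕ → ℕ
cycleDist n d = d ⊓ (n ∸ d)

CyclePacking : (ℕ → ℕ) → ℕ → (ℕ → ℕ) → Set
CyclePacking s n = PackedBy (cycleDist n) s n

palette? : ∀ k N f → Dec (Palette k N f)
palette? k N f = allUpTo? (λ i → 1 ≤? f i ×-dec f i ≤? k) N

packedBy? : ∀ δ s N f → Dec (PackedBy δ s N f)
packedBy? δ s N f = map′ packedBy separated
  (allUpTo? (λ j → allUpTo? (λ i → f i ≟ f j →-dec s (f i) <? δ (j ∸ i)) j) N)

_≤[_]_ : (ℕ → ℕ) → ℕ → (ℕ → ℕ) → Set
s ≤[ k ] t = ∀ {c} → 1 ≤ c → c ≤ k → s c ≤ t c

module _ {δ : ℕ → ℕ} {s : ℕ → ℕ} {f : ℕ → ℕ} where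

  packedBy-≤ : ∀ {M N} → M ≤ N → PackedBy δ s N f → PackedBy δ s M f
  packedBy-≤ M≤N packed = packedBy λ j<M → separated packed (<-≤-trans j<M M≤N)

  packedBy-antitone : ∀ {t k N} → Palette k N f → s ≤[ k ] t → PackedBy δ t N f → PackedBy δ s N f
  packedBy-antitone pal s≤t packed = packedBy λ j<N i<j eq →
    let (1≤c , c≤k) = pal (<-trans i<j j<N) in ≤-<-trans (s≤t 1≤c c≤k) (separated packed j<N i<j eq)

palette-≤ : ∀ {k M N f} → M ≤ N → Palette k N f → Palette k M f
palette-≤ M≤N pal i<M = pal (<-≤-trans i<M M≤N)

-- Colors that must occur

NoPacking : (ℕ → ℕ) → ℕ → ℕ → Set
NoPacking s k N = ∀ f → Palette k N f → ¬ PathPacking s N f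

module _ {s : ℕ → ℕ} where

  noPacking-mono : ∀ {k N M} → N ≤ M → NoPacking s k N → NoPacking s k M
  noPacking-mono N≤M none f pal packed = none f (palette-≤ N≤M pal) (packedBy-≤ N≤M packed)

  pathPacking-shift : ∀ {N w f} p → p + w ≤ N → PathPacking s N f → PathPacking s w (λ i → f (p + i))
  pathPacking-shift {f = f} p p+w≤N packed = packedBy λ {j} j<w {i} i<j eq →
    subst (s (f (p + i)) <_) ([m+n]∸[m+o]≡n∸o p j i)
      (separated packed (<-≤-trans (+-monoʳ-< p j<w) p+w≤N) (+-monoʳ-< p i<j) eq)

  top-color-occurs : ∀ {k w f} → NoPacking s k w → Palette (suc k) w f → PathPacking s w f →
    ∃ λ i → i < w × f i ≡ suc k
  top-color-occurs {k} {w} {f} none pal packed with anyUpTo? (λ i → f i ≟ suc k) w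
  ... | yes found = found
  ... | no absent = ⊥-elim (none f pal′ packed)
    where
    pal′ : Palette k w f
    pal′ i<w = let (1≤c , c≤1+k) = pal i<w in
      1≤c , m<1+n⇒m≤n (≤∧≢⇒< c≤1+k λ c≡1+k → absent (_ , i<w , c≡1+k))

  noPacking-zero : NoPacking s 0 1
  noPacking-zero f pal _ with pal (s≤s z≤n)
  ... | 1≤c , c≤0 = 1+n≰n (≤-trans 1≤c c≤0)

  noPacking-double : ∀ {k w} → NoPacking s k w → w ≤ s (suc k) → NoPacking s (suc k) (w + w)
  noPacking-double {k} {w} none w≤s f pal packed
    with top-color-occurs none (palette-≤ (m≤m+n w w) pal) (packedBy-≤ (m≤m+n w w) packed)
  ... | p , p<w , fp
    with top-color-occurs none (λ i<w → pal (<-≤-trans (+-monoʳ-< (suc p) i<w) (+-monoˡ-≤ w p<w)))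
                              (pathPacking-shift (suc p) (+-monoˡ-≤ w p<w) packed)
  ... | g , g<w , fq = 1+n≰n (begin
    suc (s (suc k))  ≡⟨ cong (λ c → suc (s c)) fp ⟨
    suc (s (f p))    ≤⟨ separated packed (<-≤-trans (+-monoʳ-< (suc p) g<w) (+-monoˡ-≤ w p<w))
                               (s≤s (m≤m+n p g)) (trans fp (sym fq)) ⟩
    suc p + g ∸ p    ≡⟨ cong (_∸ p) (+-suc p g) ⟨
    p + suc g ∸ p    ≡⟨ m+n∸m≡n p (suc g) ⟩
    suc g            ≤⟨ g<w ⟩
    w                ≤⟨ w≤s ⟩
    s (suc k)        ∎)
    where open ≤-Reasoning

-- Compositions

Composition : ℕ → ℕ → ℕ → Set
Composition a b n = Σ[ parts ∈ List ℕ ] All (λ g → a ≤ g × g ≤ b) parts × sum parts ≡ n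

composition-empty : ∀ {a b n} → b < a → Composition a b n → n ≡ 0
composition-empty b<a ([] , [] , total) = sym total
composition-empty b<a (_ ∷ _ , (a≤g , g≤b) ∷ _ , _) = ⊥-elim (<⇒≱ b<a (≤-trans a≤g g≤b))

module _ {a b : ℕ} where

  composition-bounds : ∀ {n} → Composition a b n → ∃ λ m → m * a ≤ n × n ≤ m * b
  composition-bounds ([] , [] , refl) = 0 , z≤n , z≤n
  composition-bounds (g ∷ parts , (a≤g , g≤b) ∷ bounds , refl)
    with composition-bounds (parts , bounds , refl)
  ... | m , lower , upper = suc m , +-mono-≤ a≤g lower , +-mono-≤ g≤b upper

  composition-from-bounds : a ≤ b → ∀ m {n} → m * a ≤ n → n ≤ m * b → Composition a b n
  composition-from-bounds a≤b zero _ n≤0 = [] , [] , sym (n≤0⇒n≡0 n≤0)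
  composition-from-bounds a≤b (suc m) {n} lower upper with ≤-total b (n ∸ m * a)
  ... | inj₁ b≤rest =
    let parts , bounds , total = composition-from-bounds a≤b m lower′ upper′ in
    b ∷ parts , (a≤b , ≤-refl) ∷ bounds , trans (cong (b +_) total) (m+[n∸m]≡n b≤n)
    where
    ma≤n = m+n≤o⇒n≤o a lower
    b+ma≤n = m≤o∸n⇒m+n≤o b ma≤n b≤rest
    b≤n = m+n≤o⇒m≤o b b+ma≤n
    lower′ = m+n≤o⇒m≤o∸n (m * a) (subst (_≤ n) (+-comm b (m * a)) b+ma≤n)
    upper′ = m≤n+o⇒m∸n≤o n b upper
  ... | inj₂ rest≤b =
    let parts , bounds , total = composition-from-bounds a≤b m ≤-refl (*-monoʳ-≤ m a≤b) in
    n ∸ m * a ∷ parts , (m+n≤o⇒m≤o∸n a lower , rest≤b) ∷ bounds ,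
    trans (cong (n ∸ m * a +_) total) (m∸n+n≡m (m+n≤o⇒n≤o a lower))

  composition? : 1 ≤ a → a ≤ b → ∀ n → Dec (Composition a b n)
  composition? 1≤a a≤b n =
    map′ (λ (m , _ , lower , upper) → composition-from-bounds a≤b m lower upper) bounded
         (anyUpTo? (λ m → m * a ≤? n ×-dec n ≤? m * b) (suc n))
    where
    bounded : ∀ {n} → Composition a b n → ∃ λ m → m < suc n × m * a ≤ n × n ≤ m * b
    bounded c with composition-bounds c
    ... | m , lower , upper =
      m , s≤s (≤-trans (subst (_≤ m * a) (*-identityʳ m) (*-monoʳ-≤ m 1≤a)) lower) , lower , upper

  composition-eventually : ∀ {N} → 1 ≤ a → a ≤ b →
    (∀ {n} → N ≤ n → n < N + a → Composition a b n) → ∀ n → N ≤ n → Composition a b n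
  composition-eventually {N} 1≤a a≤b base = <-rec _ step
    where
    step : ∀ n → (∀ {m} → m < n → N ≤ m → Composition a b m) → N ≤ n → Composition a b n
    step n rec N≤n with n <? N + a
    ... | yes n<N+a = base N≤n n<N+a
    ... | no n≮N+a =
      let N+a≤n = ≮⇒≥ n≮N+a
          a≤n = m+n≤o⇒n≤o N N+a≤n
          parts , bounds , total = rec (∸-monoʳ-< 1≤a a≤n) (m+n≤o⇒m≤o∸n N N+a≤n)
      in a ∷ parts , (≤-refl , a≤b) ∷ bounds , trans (cong (a +_) total) (m+[n∸m]≡n a≤n)

-- Gaps between occurrences of the top color on a cycle

PackedWithin : (ℕ → ℕ) → ℕ → (ℕ → ℕ) → Set
PackedWithin s n f = ∀ {p q} → p < q → q < p + n → f p ≡ f q → s (f p) < q ∸ p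

module Gaps {s : ℕ → ℕ} {k w n : ℕ} {f : ℕ → ℕ}
  (none : NoPacking s k w) (w<n : w < n)
  (colors : ∀ i → 1 ≤ f i × f i ≤ suc k) (packed : PackedWithin s n f) where

  window : ∀ p → PathPacking s w (λ i → f (p + i))
  window p = packedBy λ {j} j<w {i} i<j eq →
    subst (s (f (p + i)) <_) ([m+n]∸[m+o]≡n∸o p j i)
      (packed (+-monoʳ-< p i<j)
              (subst (p + j <_) (sym (+-assoc p i n))
                (+-monoʳ-< p (<-≤-trans j<w (≤-trans (<⇒≤ w<n) (m≤n+m n i)))))
              eq)

  next-occurrence : ∀ p → ∃ λ g → 0 < g × g ≤ w × f (p + g) ≡ suc k
  next-occurrence p with top-color-occurs none (λ _ → colors _) (window (suc p))
  ... | i , i<w , fi = suc i , s≤s z≤n , i<w , subst (λ q → f q ≡ suc k) (sym (+-suc p i)) fi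

  gap-bound : ∀ {p g} → 0 < g → g < n → f p ≡ suc k → f (p + g) ≡ suc k → s (suc k) < g
  gap-bound {p} {g} 0<g g<n fp fq =
    subst₂ _<_ (cong s fp) (m+n∸m≡n p g) (packed (m<m+n p 0<g) (+-monoʳ-< p g<n) (trans fp (sym fq)))

  ArcComposition : ℕ → Set
  ArcComposition m = ∀ {p} → f p ≡ suc k → f (p + m) ≡ suc k → 0 < m → m ≤ n →
    Composition (suc (s (suc k))) w m

  arc-composition : ∀ m → ArcComposition m
  arc-composition = <-rec ArcComposition step
    where
    step : ∀ m → (∀ {m′} → m′ < m → ArcComposition m′) → ArcComposition m
    step m rec {p} fp fpm 0<m m≤n with next-occurrence p
    ... | g , 0<g , g≤w , fq with g <? m
    ...   | no g≮m = m ∷ [] , (gap-bound 0<m m<n fp fpm , ≤-trans m≤g g≤w) ∷ [] , +-identityʳ m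
      where
      m≤g = ≮⇒≥ g≮m
      m<n = ≤-<-trans (≤-trans m≤g g≤w) w<n
    ...   | yes g<m with rec (∸-monoʳ-< 0<g (<⇒≤ g<m)) fq fpm′ (m<n⇒0<n∸m g<m) (≤-trans (m∸n≤m m g) m≤n)
      where
      fpm′ : f (p + g + (m ∸ g)) ≡ suc k
      fpm′ = subst (λ q → f q ≡ suc k)
        (trans (sym (cong (p +_) (m+[n∸m]≡n (<⇒≤ g<m)))) (sym (+-assoc p g (m ∸ g)))) fpm
    ... | parts , bounds , total =
      g ∷ parts , (gap-bound 0<g (<-≤-trans g<m m≤n) fp fq , g≤w) ∷ bounds ,
      trans (cong (g +_) total) (m+[n∸m]≡n (<⇒≤ g<m))

  cycle-composition : (∀ p → f (p + n) ≡ f p) → Composition (suc (s (suc k))) w n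
  cycle-composition periodic with next-occurrence 0
  ... | g , _ , _ , fg = arc-composition n fg (trans (periodic g) fg) (≤-<-trans z≤n w<n) ≤-refl

at : List ℕ → ℕ → ℕ
at [] _ = 0
at (c ∷ _) zero = c
at (_ ∷ w) (suc i) = at w i

at-++ˡ : ∀ u v {i} → i < length u → at (u ++ v) i ≡ at u i
at-++ˡ (c ∷ u) v {zero} _ = refl
at-++ˡ (c ∷ u) v {suc i} i<|u| = at-++ˡ u v (s≤s⁻¹ i<|u|)

at-++ʳ : ∀ u v i → at (u ++ v) (length u + i) ≡ at v i
at-++ʳ [] v i = refl
at-++ʳ (c ∷ u) v i = at-++ʳ u v i

at-++-≥ : ∀ u v {i} → length u ≤ i → at (u ++ v) i ≡ at v (i ∸ length u)
at-++-≥ u v {i} |u|≤i = trans (cong (at (u ++ v)) (sym (m+[n∸m]≡n |u|≤i))) (at-++ʳ u v (i ∸ length u))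

palette-at : ∀ {k} {w : List ℕ} → All (λ c → 1 ≤ c × c ≤ k) w → Palette k (length w) (at w)
palette-at (c∈ ∷ _) {zero} _ = c∈
palette-at (_ ∷ all) {suc i} i<|w| = palette-at all (s≤s⁻¹ i<|w|)

packedBy-cong : ∀ {δ s N f g} → (∀ {i} → i < N → f i ≡ g i) → PackedBy δ s N f → PackedBy δ s N g
packedBy-cong {s = s} {g = g} f≗g packed = packedBy λ {j} j<N {i} i<j eq →
  subst (λ c → s c < _) (f≗g (<-trans i<j j<N))
    (separated packed j<N i<j (trans (f≗g (<-trans i<j j<N)) (trans eq (sym (f≗g j<N)))))

module _ {t : ℕ → ℕ} {M : ℕ} (t≤M : ∀ c → t c ≤ M) where

  packing-join : ∀ u v w → M ≤ length v →
    PathPacking t (length (u ++ v)) (at (u ++ v)) → PathPacking t (length (v ++ w)) (at (v ++ w)) →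
    PathPacking t (length (u ++ v ++ w)) (at (u ++ v ++ w))
  packing-join u v w M≤|v| uv vw = packedBy separate
    where
    uvw = u ++ v ++ w
    prefix : ∀ {x} → x < length (u ++ v) → at uvw x ≡ at (u ++ v) x
    prefix {x} x< = trans (cong (λ z → at z x) (sym (++-assoc u v w))) (at-++ˡ (u ++ v) w x<)
    suffix : ∀ {x} → length u ≤ x → at uvw x ≡ at (v ++ w) (x ∸ length u)
    suffix = at-++-≥ u (v ++ w)
    separate : ∀ {j} → j < length uvw → ∀ {i} → i < j → at uvw i ≡ at uvw j → t (at uvw i) < j ∸ i
    separate {j} j<|uvw| {i} i<j eq with j <? length (u ++ v) | i <? length u
    ... | yes j<|uv| | _ = separated (packedBy-cong (λ x< → sym (prefix x<)) uv) j<|uv| i<j eq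
    ... | no j≮|uv| | yes i<|u| = <-≤-trans (s≤s (≤-trans (t≤M _) M≤|v|)) far
      where
      open ≤-Reasoning
      far : suc (length v) ≤ j ∸ i
      far = m+n≤o⇒m≤o∸n (suc (length v)) (begin
        suc (length v) + i   ≡⟨ +-suc (length v) i ⟨
        length v + suc i     ≤⟨ +-monoʳ-≤ (length v) i<|u| ⟩
        length v + length u  ≡⟨ +-comm (length v) (length u) ⟩
        length u + length v  ≡⟨ length-++ u ⟨
        length (u ++ v)      ≤⟨ ≮⇒≥ j≮|uv| ⟩
        j                    ∎)
    ... | no j≮|uv| | no i≮|u| =
      subst₂ (λ c d → t c < d) (sym (suffix |u|≤i)) shift
        (separated vw j′<|vw| (∸-monoˡ-< i<j |u|≤i) (trans (sym (suffix |u|≤i)) (trans eq (suffix |u|≤j))))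
      where
      |u|≤i = ≮⇒≥ i≮|u|
      |u|≤j = <⇒≤ (≤-<-trans |u|≤i i<j)
      j′<|vw| : j ∸ length u < length (v ++ w)
      j′<|vw| = subst (j ∸ length u <_) (m+n∸m≡n (length u) (length (v ++ w)))
        (∸-monoˡ-< (subst (j <_) (length-++ u) j<|uvw|) |u|≤j)
      shift : j ∸ length u ∸ (i ∸ length u) ≡ j ∸ i
      shift = trans (sym ([m+n]∸[m+o]≡n∸o (length u) (j ∸ length u) (i ∸ length u)))
                    (cong₂ _∸_ (m+[n∸m]≡n |u|≤j) (m+[n∸m]≡n |u|≤i))

  concat-packing : ∀ {P : ℕ → Set} (word : ℕ → List ℕ) → (∀ g → P g → M ≤ length (word g)) →
    (∀ g h → P g → P h → PathPacking t (length (word g ++ word h)) (at (word g ++ word h))) →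
    ∀ {gs} → All P gs → PathPacking t (length (concat (map word gs))) (at (concat (map word gs)))
  concat-packing word long fits [] = packedBy λ ()
  concat-packing word long fits {g ∷ []} (Pg ∷ []) =
    subst (λ u → PathPacking t (length u) (at u)) (sym (++-identityʳ (word g)))
      (packedBy-cong (at-++ˡ (word g) (word g))
        (packedBy-≤ (subst (length (word g) ≤_) (sym (length-++ (word g))) (m≤m+n _ _)) (fits g g Pg Pg)))
  concat-packing word long fits {g ∷ h ∷ gs} (Pg ∷ Ph ∷ Pgs) =
    packing-join (word g) (word h) (concat (map word gs)) (long h Ph) (fits g h Pg Ph)
      (concat-packing word long fits (Ph ∷ Pgs))

-- Colors 3 and 4 occur once per block, hence recur more than d positions apart in any
-- concatenation of blocks longer than d.
block : ℕ → List ℕ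
block g = 1 ∷ 2 ∷ 1 ∷ 3 ∷ take (g ∸ 5) (1 ∷ 2 ∷ 1 ∷ []) ++ 4 ∷ []

-- The packing sequence (1, 2, d, d, …); its value at 0 is irrelevant, color 0 is never used.
upper : ℕ → ℕ → ℕ
upper d 1 = 1
upper d 2 = 2
upper d _ = d

upper-mono : ∀ {d e} → d ≤ e → ∀ c → upper d c ≤ upper e c
upper-mono d≤e 1 = ≤-refl
upper-mono d≤e 2 = ≤-refl
upper-mono d≤e 0 = d≤e
upper-mono d≤e (suc (suc (suc c))) = d≤e

upper-≤ : ∀ {d} → 2 ≤ d → ∀ c → upper d c ≤ d
upper-≤ 2≤d 1 = ≤-trans (s≤s z≤n) 2≤d
upper-≤ 2≤d 2 = 2≤d
upper-≤ 2≤d 0 = ≤-refl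
upper-≤ 2≤d (suc (suc (suc c))) = ≤-refl

block-palette : ∀ g → All (λ c → 1 ≤ c × c ≤ 4) (block g)
block-palette g = c₁ ∷ c₂ ∷ c₁ ∷ c₃ ∷ ++⁺ (take⁺ (g ∸ 5) (c₁ ∷ c₂ ∷ c₁ ∷ [])) (c₄ ∷ [])
  where
  c₁ = s≤s z≤n , s≤s z≤n
  c₂ = s≤s z≤n , s≤s (s≤s z≤n)
  c₃ = s≤s z≤n , s≤s (s≤s (s≤s z≤n))
  c₄ = s≤s z≤n , ≤-refl

block-length : ∀ {g} → 5 ≤ g → g ≤ 8 → length (block g) ≡ g
block-length 5≤g g≤8 = toWitness {a? = allUpTo? (λ g → 5 ≤? g →-dec length (block g) ≟ g) 9} _ (s≤s g≤8) 5≤g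

blocks-fit : ∀ {g h} → 5 ≤ g → g ≤ 8 → 5 ≤ h → h ≤ 8 →
  PathPacking (upper (g ⊓ h ∸ 1)) (length (block g ++ block h)) (at (block g ++ block h))
blocks-fit 5≤g g≤8 5≤h h≤8 =
  toWitness {a? = allUpTo? (λ g → allUpTo? (fits? g) 9) 9} _ (s≤s g≤8) (s≤s h≤8) 5≤g 5≤h
  where
  fits? : ∀ g h → Dec (5 ≤ g → 5 ≤ h →
    PathPacking (upper (g ⊓ h ∸ 1)) (length (block g ++ block h)) (at (block g ++ block h)))
  fits? g h = 5 ≤? g →-dec 5 ≤? h →-dec
    packedBy? id (upper (g ⊓ h ∸ 1)) (length (block g ++ block h)) (at (block g ++ block h))

module _ {d : ℕ} (4≤d : 4 ≤ d) where

  private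
    5≤ : ∀ {g} → suc d ≤ g → 5 ≤ g
    5≤ d<g = ≤-trans (s≤s 4≤d) d<g

  blocks-packing : ∀ {gs} → All (λ g → suc d ≤ g × g ≤ 8) gs →
    PathPacking (upper d) (length (concat (map block gs))) (at (concat (map block gs)))
  blocks-packing = concat-packing (upper-≤ (≤-trans (s≤s (s≤s z≤n)) 4≤d)) block long fits
    where
    long : ∀ g → suc d ≤ g × g ≤ 8 → d ≤ length (block g)
    long g (d<g , g≤8) = ≤-trans (n≤1+n d) (≤-trans d<g (≤-reflexive (sym (block-length (5≤ d<g) g≤8))))
    fits : ∀ g h → suc d ≤ g × g ≤ 8 → suc d ≤ h × h ≤ 8 →
      PathPacking (upper d) (length (block g ++ block h)) (at (block g ++ block h))
    fits g h (d<g , g≤8) (d<h , h≤8) =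
      packedBy-antitone (palette-at (++⁺ (block-palette g) (block-palette h)))
        (λ _ _ → upper-mono (∸-monoˡ-≤ 1 (⊓-glb d<g d<h)) _)
        (blocks-fit (5≤ d<g) g≤8 (5≤ d<h) h≤8)

  blocks-length : ∀ {gs} → All (λ g → suc d ≤ g × g ≤ 8) gs → length (concat (map block gs)) ≡ sum gs
  blocks-length [] = refl
  blocks-length {g ∷ gs} ((d<g , g≤8) ∷ bounds) =
    trans (length-++ (block g)) (cong₂ _+_ (block-length (5≤ d<g) g≤8) (blocks-length bounds))

  blocks-palette : ∀ gs → Palette 4 (length (concat (map block gs))) (at (concat (map block gs)))
  blocks-palette gs = palette-at (concat⁺ (map⁺ (all-blocks gs)))
    where
    all-blocks : ∀ gs → All (All (λ c → 1 ≤ c × c ≤ 4) ∘ block) gs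
    all-blocks [] = []
    all-blocks (g ∷ gs) = block-palette g ∷ all-blocks gs

cyclePacking-doubled : ∀ {t n} (w : List ℕ) → length w ≡ n → PathPacking t (n + n) (at (w ++ w)) →
  CyclePacking t n (at w)
cyclePacking-doubled {t} w refl doubled = packedBy separate
  where
  n = length w
  first : ∀ {i} → i < n → at (w ++ w) i ≡ at w i
  first = at-++ˡ w w
  separate : ∀ {j} → j < n → ∀ {i} → i < j → at w i ≡ at w j → t (at w i) < cycleDist n (j ∸ i)
  separate {j} j<n {i} i<j eq = ⊓-glb inside around
    where
    i<n = <-trans i<j j<n
    inside : t (at w i) < j ∸ i
    inside = subst (λ c → t c < j ∸ i) (first i<n)
      (separated doubled (<-≤-trans j<n (m≤m+n n n)) i<j (trans (first i<n) (trans eq (sym (first j<n)))))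
    wrap : n + i ∸ j ≡ n ∸ (j ∸ i)
    wrap = trans (cong₂ _∸_ (+-comm n i) (sym (m+[n∸m]≡n (<⇒≤ i<j)))) ([m+n]∸[m+o]≡n∸o i n (j ∸ i))
    around : t (at w i) < n ∸ (j ∸ i)
    around = subst₂ (λ c e → t c < e) (trans (first j<n) (sym eq)) wrap
      (separated doubled (+-monoʳ-< n i<n) (<-≤-trans j<n (m≤m+n n i))
        (trans (first j<n) (trans (sym eq) (sym (at-++ʳ w w i)))))

ruler : ℕ → ℕ → ℕ
ruler a = at (concat (map block (replicate a 8)))

module _ (a : ℕ) where

  private
    4≤7 : 4 ≤ 7
    4≤7 = s≤s (s≤s (s≤s (s≤s z≤n)))

    eights : All (λ g → 8 ≤ g × g ≤ 8) (replicate a 8)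
    eights = replicate⁺ a (≤-refl , ≤-refl)

    sum-eights : ∀ a → sum (replicate a 8) ≡ a * 8
    sum-eights zero = refl
    sum-eights (suc a) = cong (8 +_) (sum-eights a)

    length≡ : length (concat (map block (replicate a 8))) ≡ a * 8
    length≡ = trans (blocks-length 4≤7 eights) (sum-eights a)

  ruler-packing : PathPacking (upper 7) (a * 8) (ruler a)
  ruler-packing = subst (λ N → PathPacking (upper 7) N (ruler a)) length≡ (blocks-packing 4≤7 eights)

  ruler-palette : Palette 4 (a * 8) (ruler a)
  ruler-palette = subst (λ N → Palette 4 N (ruler a)) length≡ (blocks-palette 4≤7 (replicate a 8))

module _ {n : ℕ} .{{_ : NonZero n}} where

  %-absorbˡ : ∀ m o → (m % n + o) % n ≡ (m + o) % n
  %-absorbˡ m o = begin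
    (m % n + o) % n                ≡⟨ [m+kn]%n≡m%n (m % n + o) (m / n) n ⟨
    (m % n + o + m / n * n) % n    ≡⟨ cong (_% n) (+-assoc (m % n) o (m / n * n)) ⟩
    (m % n + (o + m / n * n)) % n  ≡⟨ cong (λ x → (m % n + x) % n) (+-comm o (m / n * n)) ⟩
    (m % n + (m / n * n + o)) % n  ≡⟨ cong (_% n) (+-assoc (m % n) (m / n * n) o) ⟨
    (m % n + m / n * n + o) % n    ≡⟨ cong (λ x → (x + o) % n) (m≡m%n+[m/n]*n m n) ⟨
    (m + o) % n                    ∎
    where open ≡-Reasoning

  %-suc : ∀ m → suc m % n ≡ suc (m % n) % n
  %-suc m = begin
    suc m % n        ≡⟨ cong (_% n) (+-comm 1 m) ⟩
    (m + 1) % n      ≡⟨ %-absorbˡ m 1 ⟨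
    (m % n + 1) % n  ≡⟨ cong (_% n) (+-comm (m % n) 1) ⟩
    suc (m % n) % n  ∎
    where open ≡-Reasoning

  %-shift-≢ : ∀ {x δ} → x < n → 0 < δ → δ < n → x ≢ (x + δ) % n
  %-shift-≢ {x} {δ} x<n 0<δ δ<n x≡ with x + δ <? n
  ... | yes x+δ<n = <-irrefl (trans x≡ (m<n⇒m%n≡m x+δ<n)) (m<m+n x 0<δ)
  ... | no x+δ≮n =
    <-irrefl (sym (trans x≡ (trans (sym (m≤n⇒[n∸m]%m≡n%m n≤x+δ)) (m<n⇒m%n≡m (<-trans wrapped<x x<n)))))
             wrapped<x
    where
    n≤x+δ = ≮⇒≥ x+δ≮n
    wrapped<x : x + δ ∸ n < x
    wrapped<x = subst (x + δ ∸ n <_) (m+n∸n≡m x n) (∸-monoˡ-< (+-monoʳ-< x δ<n) n≤x+δ)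

  %-distinct : ∀ {p q} → p < q → q < p + n → p % n ≢ q % n
  %-distinct {p} {q} p<q q<p+n p%≡q% =
    %-shift-≢ (m%n<n p n) (m<n⇒0<n∸m p<q) δ<n (trans p%≡q% q%≡)
    where
    q%≡ : q % n ≡ (p % n + (q ∸ p)) % n
    q%≡ = trans (cong (_% n) (sym (m+[n∸m]≡n (<⇒≤ p<q)))) (sym (%-absorbˡ p (q ∸ p)))
    δ<n : q ∸ p < n
    δ<n = subst (q ∸ p <_) (m+n∸m≡n p n) (∸-monoˡ-< q<p+n (<⇒≤ p<q))

-- Walks in cycles and their proper subgraphs

∨-elim-true : ∀ a {b} → a ∨ b ≡ true → a ≡ true ⊎ b ≡ true
∨-elim-true true _ = inj₁ refl
∨-elim-true false b≡true = inj₂ b≡true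

∨-introˡ-true : ∀ {a} b → a ≡ true → a ∨ b ≡ true
∨-introˡ-true b refl = refl

∨-introʳ-true : ∀ a {b} → b ≡ true → a ∨ b ≡ true
∨-introʳ-true true _ = refl
∨-introʳ-true false b≡true = b≡true

∧-elim-true : ∀ a {b} → a ∧ b ≡ true → a ≡ true × b ≡ true
∧-elim-true true b≡true = refl , b≡true

≡ᵇ-true⇒≡ : ∀ m n → (m ≡ᵇ n) ≡ true → m ≡ n
≡ᵇ-true⇒≡ m n e = ≡ᵇ⇒≡ m n (Equivalence.from T-≡ e)

≡⇒≡ᵇ-true : ∀ {m n} → m ≡ n → (m ≡ᵇ n) ≡ true
≡⇒≡ᵇ-true {m} {n} m≡n = Equivalence.to T-≡ (≡⇒≡ᵇ m n m≡n)

nextOf-cases : ∀ {n} (x y : Fin n) → nextOf n x y ≡ true →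
  (toℕ y ≡ suc (toℕ x)) ⊎ (suc (toℕ x) ≡ n × toℕ y ≡ 0)
nextOf-cases {n} x y e with ∨-elim-true (suc (toℕ x) ≡ᵇ toℕ y) e
... | inj₁ 1+x≡y = inj₁ (sym (≡ᵇ-true⇒≡ _ _ 1+x≡y))
... | inj₂ wraps = let 1+x≡n , y≡0 = ∧-elim-true (suc (toℕ x) ≡ᵇ n) wraps in
  inj₂ (≡ᵇ-true⇒≡ _ _ 1+x≡n , ≡ᵇ-true⇒≡ _ _ y≡0)

module _ {n : ℕ} .{{_ : NonZero n}} where

  nextOf⇒succ : ∀ (x y : Fin n) → nextOf n x y ≡ true → toℕ y ≡ suc (toℕ x) % n
  nextOf⇒succ x y e with nextOf-cases x y e
  ... | inj₁ y≡ = trans y≡ (sym (m<n⇒m%n≡m (subst (_< n) y≡ (toℕ<n y))))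
  ... | inj₂ (1+x≡n , y≡0) = trans y≡0 (sym (trans (cong (_% n) 1+x≡n) (n%n≡0 n)))

  succ⇒nextOf : ∀ (x y : Fin n) → toℕ y ≡ suc (toℕ x) % n → nextOf n x y ≡ true
  succ⇒nextOf x y y≡ with m≤n⇒m<n∨m≡n (toℕ<n x)
  ... | inj₁ 1+x<n = ∨-introˡ-true _ (≡⇒≡ᵇ-true (sym (trans y≡ (m<n⇒m%n≡m 1+x<n))))
  ... | inj₂ 1+x≡n = ∨-introʳ-true _
          (cong₂ _∧_ (≡⇒≡ᵇ-true 1+x≡n) (≡⇒≡ᵇ-true (trans y≡ (trans (cong (_% n) 1+x≡n) (n%n≡0 n)))))

module _ {m : ℕ} {G : Graph m} where

  walk-along : (v : ℕ → Fin m) → (∀ i → inV G (v i) ≡ true) → ∀ p ℓ →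
    (∀ {i} → p ≤ i → i < p + ℓ → inE G (v i) (v (suc i)) ≡ true) → Walk G (v p) (v (p + ℓ)) ℓ
  walk-along v inV p zero _ = subst (λ q → Walk G (v p) (v q) 0) (sym (+-identityʳ p)) (nil (inV p))
  walk-along v inV p (suc ℓ) edge =
    cons (edge ≤-refl (m<m+n p z<s))
         (subst (λ q → Walk G (v (suc p)) (v q) ℓ) (sym (+-suc p ℓ))
           (walk-along v inV (suc p) ℓ λ {i} p<i i<1+p+ℓ →
             edge (<⇒≤ p<i) (subst (i <_) (sym (+-suc p ℓ)) i<1+p+ℓ)))

  walk-potential : (h : Fin m → ℕ) → (∀ x y → inE G x y ≡ true → h x ≤ suc (h y)) →
    ∀ {u v ℓ} → Walk G u v ℓ → h u ≤ ℓ + h v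
  walk-potential h lipschitz (nil _) = ≤-refl
  walk-potential h lipschitz (cons e w) = ≤-trans (lipschitz _ _ e) (s≤s (walk-potential h lipschitz w))

Near : ℕ → ℕ → Set
Near a b = a ≤ suc b × b ≤ suc a

∣m-1+m∣≡1 : ∀ m → ∣ m - suc m ∣ ≡ 1
∣m-1+m∣≡1 zero = refl
∣m-1+m∣≡1 (suc m) = ∣m-1+m∣≡1 m

near-∣suc-∣ : ∀ a t → Near ∣ a - t ∣ ∣ suc a - t ∣
near-∣suc-∣ a t =
  ≤-trans (∣-∣-triangle a (suc a) t) (≤-reflexive (cong (_+ ∣ suc a - t ∣) (∣m-1+m∣≡1 a))) ,
  ≤-trans (∣-∣-triangle (suc a) a t)
          (≤-reflexive (cong (_+ ∣ a - t ∣) (trans (∣-∣-comm (suc a) a) (∣m-1+m∣≡1 a))))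

∸-suc-≤ : ∀ n d → n ∸ d ≤ suc (n ∸ suc d)
∸-suc-≤ zero d = ≤-trans (≤-reflexive (0∸n≡0 d)) z≤n
∸-suc-≤ (suc n) zero = ≤-refl
∸-suc-≤ (suc n) (suc d) = ∸-suc-≤ n d

module _ {n : ℕ} where

  cycleDist-near : ∀ {d d′} → Near d d′ → Near (cycleDist n d) (cycleDist n d′)
  cycleDist-near {d} {d′} (d≤ , d′≤) = ⊓-mono-≤ d≤ (∸-near d′≤) , ⊓-mono-≤ d′≤ (∸-near d≤)
    where
    ∸-near : ∀ {a b} → b ≤ suc a → n ∸ a ≤ suc (n ∸ b)
    ∸-near {a} b≤ = ≤-trans (∸-suc-≤ n a) (s≤s (∸-monoʳ-≤ n b≤))

  cycleDist-flip : ∀ {d} → d ≤ n → cycleDist n (n ∸ d) ≡ cycleDist n d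
  cycleDist-flip {d} d≤n = trans (cong ((n ∸ d) ⊓_) (m∸[m∸n]≡n d≤n)) (⊓-comm (n ∸ d) d)

  cycle-near : ∀ (x y : Fin n) {t} → t < n → nextOf n x y ≡ true →
    Near (cycleDist n ∣ toℕ x - t ∣) (cycleDist n ∣ toℕ y - t ∣)
  cycle-near x y {t} t<n e with nextOf-cases x y e
  ... | inj₁ y≡ rewrite y≡ = cycleDist-near (near-∣suc-∣ (toℕ x) t)
  ... | inj₂ (1+x≡n , y≡0) rewrite y≡0 =
    subst₂ Near (sym at-x) (sym at-0) (cycleDist-near (m≤n⇒m≤1+n (n≤1+n _) , ≤-refl))
    where
    t≤x : t ≤ toℕ x
    t≤x = s≤s⁻¹ (subst (t <_) (sym 1+x≡n) t<n)
    at-x : cycleDist n ∣ toℕ x - t ∣ ≡ cycleDist n (toℕ x ∸ t)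
    at-x = cong (cycleDist n) (m≤n⇒∣n-m∣≡n∸m t≤x)
    at-0 : cycleDist n t ≡ cycleDist n (suc (toℕ x ∸ t))
    at-0 = trans (sym (cycleDist-flip (<⇒≤ t<n)))
                 (cong (cycleDist n) (trans (cong (_∸ t) (sym 1+x≡n)) (+-∸-assoc 1 t≤x)))

  cycle-walk : ∀ {u v : Fin n} {ℓ} → Walk (Cycle n) u v ℓ → cycleDist n ∣ toℕ u - toℕ v ∣ ≤ ℓ
  cycle-walk {v = v} {ℓ} w =
    subst (_ ≤_) (trans (cong (λ d → ℓ + cycleDist n d) (∣n-n∣≡0 (toℕ v))) (+-identityʳ ℓ))
    (walk-potential {G = Cycle n} (λ x → cycleDist n ∣ toℕ x - toℕ v ∣) lipschitz w)
    where
    lipschitz : ∀ x y → inE (Cycle n) x y ≡ true →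
      cycleDist n ∣ toℕ x - toℕ v ∣ ≤ suc (cycleDist n ∣ toℕ y - toℕ v ∣)
    lipschitz x y e with ∨-elim-true (nextOf n x y) e
    ... | inj₁ xy = proj₁ (cycle-near x y (toℕ<n v) xy)
    ... | inj₂ yx = proj₂ (cycle-near y x (toℕ<n v) yx)

Missing : ∀ {n} → Graph n → Fin n → Set
Missing {n} H r = ∀ {x y} → inE H x y ≡ true → nextOf n x y ≡ true → x ≢ r

module _ {n : ℕ} .{{_ : NonZero n}} {H : Graph n} where

  private
    true≢false : true ≢ false
    true≢false ()

    next-unique : ∀ {x y z : Fin n} → nextOf n x y ≡ true → nextOf n x z ≡ true → y ≡ z
    next-unique {x} {y} {z} xy xz = toℕ-injective (trans (nextOf⇒succ x y xy) (sym (nextOf⇒succ x z xz)))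

  missing : ProperSubgraph H (Cycle n) → ∃ (Missing H)
  missing (sub , inj₁ (r , _ , r∉H)) = r , λ {x} e _ x≡r →
    true≢false (trans (sym (subst (λ z → inV H z ≡ true) x≡r (IsSubgraph.E-ends sub x _ e))) r∉H)
  missing (sub , inj₂ (u , v , uv∈C , uv∉H)) with ∨-elim-true (nextOf n u v) uv∈C
  ... | inj₁ uv = u , λ { e xy refl → true≢false (trans (sym e)
                          (subst (λ z → inE H u z ≡ false) (next-unique uv xy) uv∉H)) }
  ... | inj₂ vu = v , λ { e xy refl → true≢false (trans (sym e)
                          (subst (λ z → inE H v z ≡ false) (next-unique vu xy)
                            (trans (IsSubgraph.E-sym sub v u) uv∉H))) }

-- Cutting C_n at the missing edge r → r + 1 leaves a path; rotate numbers it from r + 1 to r.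
module Rotation {n : ℕ} .{{_ : NonZero n}} (r : Fin n) where

  private
    offset = n ∸ suc (toℕ r)

  rotate : Fin n → ℕ
  rotate x = (toℕ x + offset) % n

  rotate<n : ∀ x → rotate x < n
  rotate<n x = m%n<n _ n

  private
    within-turn : ∀ (a b : Fin n) → toℕ b + offset < toℕ a + offset + n
    within-turn a b = subst (toℕ b + offset <_)
      (trans (+-assoc (toℕ a) n offset)
        (trans (cong (toℕ a +_) (+-comm n offset)) (sym (+-assoc (toℕ a) offset n))))
      (+-monoˡ-< offset (<-≤-trans (toℕ<n b) (m≤n+m n (toℕ a))))

  rotate-injective : ∀ {x y} → rotate x ≡ rotate y → x ≡ y
  rotate-injective {x} {y} eq with <-cmp (toℕ x) (toℕ y)
  ... | tri< x<y _ _ = ⊥-elim (%-distinct (+-monoˡ-< offset x<y) (within-turn x y) eq)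
  ... | tri≈ _ x≡y _ = toℕ-injective x≡y
  ... | tri> _ _ y<x = ⊥-elim (%-distinct (+-monoˡ-< offset y<x) (within-turn y x) (sym eq))

  rotate-last : suc (rotate r) ≡ n
  rotate-last = trans (cong suc (m<n⇒m%n≡m (≤-reflexive last))) last
    where
    last : suc (toℕ r + offset) ≡ n
    last = m+[n∸m]≡n (toℕ<n r)

  rotate-next : ∀ {x y} → nextOf n x y ≡ true → x ≢ r → rotate y ≡ suc (rotate x)
  rotate-next {x} {y} e x≢r = begin
    (toℕ y + offset) % n               ≡⟨ cong (λ z → (z + offset) % n) (nextOf⇒succ x y e) ⟩
    (suc (toℕ x) % n + offset) % n     ≡⟨ %-absorbˡ (suc (toℕ x)) offset ⟩
    suc (toℕ x + offset) % n           ≡⟨ %-suc (toℕ x + offset) ⟩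
    suc (rotate x) % n                 ≡⟨ m<n⇒m%n≡m (≤∧≢⇒< (rotate<n x) not-last) ⟩
    suc (rotate x)                     ∎
    where
    open ≡-Reasoning
    not-last : suc (rotate x) ≢ n
    not-last eq = x≢r (rotate-injective (suc-injective (trans eq (sym rotate-last))))

  rotated-walk : ∀ {H} → IsSubgraph H (Cycle n) → Missing H r →
    ∀ {u v ℓ} → Walk H u v ℓ → ∣ rotate u - rotate v ∣ ≤ ℓ
  rotated-walk {H} sub miss {v = v} {ℓ} w =
    subst (_ ≤_) (trans (cong (ℓ +_) (∣n-n∣≡0 (rotate v))) (+-identityʳ ℓ))
      (walk-potential (λ x → ∣ rotate x - rotate v ∣) lipschitz w)
    where
    lipschitz : ∀ x y → inE H x y ≡ true → ∣ rotate x - rotate v ∣ ≤ suc ∣ rotate y - rotate v ∣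
    lipschitz x y e with ∨-elim-true (nextOf n x y) (IsSubgraph.E⊆ sub x y e)
    ... | inj₁ xy = subst (λ z → ∣ rotate x - rotate v ∣ ≤ suc ∣ z - rotate v ∣)
                      (sym (rotate-next xy (miss e xy)))
                      (proj₁ (near-∣suc-∣ (rotate x) (rotate v)))
    ... | inj₂ yx = subst (λ z → ∣ z - rotate v ∣ ≤ suc ∣ rotate y - rotate v ∣)
                      (sym (rotate-next yx (miss (trans (IsSubgraph.E-sym sub y x) e) yx)))
                      (proj₂ (near-∣suc-∣ (rotate y) (rotate v)))

-- From sequences to colorings and back

colorable-by-labels : ∀ {m} {G : Graph m} {δ s k N f} (label : Fin m → ℕ) →
  (∀ {u v} → label u ≡ label v → u ≡ v) → (∀ u → label u < N) →
  (∀ {u v ℓ} → Walk G u v ℓ → δ ∣ label u - label v ∣ ≤ ℓ) →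
  Palette k N f → PackedBy δ s N f → PackingColorable G s k
colorable-by-labels {G = G} {δ} {s} {f = f} label injective bounded walk pal packed =
  (λ u → f (label u)) , (λ u _ → pal (bounded u)) , apart
  where
  apart : ∀ u v → inV G u ≡ true → inV G v ≡ true → ¬ u ≡ v →
    f (label u) ≡ f (label v) → DistGt G u v (s (f (label u)))
  apart u v _ _ u≢v eq ℓ w with <-cmp (label u) (label v)
  ... | tri< lu<lv _ _ =
    <-≤-trans (subst (λ d → s (f (label u)) < δ d) (sym (m≤n⇒∣m-n∣≡n∸m (<⇒≤ lu<lv)))
                (separated packed (bounded v) lu<lv eq))
              (walk w)
  ... | tri≈ _ lu≡lv _ = ⊥-elim (u≢v (injective lu≡lv))
  ... | tri> _ _ lv<lu = subst (λ c → s c < ℓ) (sym eq)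
    (<-≤-trans (subst (λ d → s (f (label v)) < δ d) (sym (m≤n⇒∣n-m∣≡n∸m (<⇒≤ lv<lu)))
                 (separated packed (bounded u) lv<lu (sym eq)))
               (walk w))

module _ {n : ℕ} .{{_ : NonZero n}} {s : ℕ → ℕ} {k : ℕ} {f : ℕ → ℕ} where

  cycle-colorable : Palette k n f → CyclePacking s n f → PackingColorable (Cycle n) s k
  cycle-colorable = colorable-by-labels toℕ toℕ-injective toℕ<n cycle-walk

  properSubgraph-colorable : ∀ {H} → ProperSubgraph H (Cycle n) →
    Palette k n f → PathPacking s n f → PackingColorable H s k
  properSubgraph-colorable proper with missing proper
  ... | r , miss = colorable-by-labels rotate rotate-injective rotate<n (rotated-walk (proj₁ proper) miss)
    where open Rotation r

PathGraph : ∀ n → Graph n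
PathGraph n = record { inV = λ _ → true ; inE = λ x y → (suc (toℕ x) ≡ᵇ toℕ y) ∨ (suc (toℕ y) ≡ᵇ toℕ x) }

module _ {n : ℕ} .{{_ : NonZero n}} where

  toℕ-mod : ∀ i → toℕ (i mod n) ≡ i % n
  toℕ-mod i = toℕ-fromℕ< (m%n<n i n)

  walk-mod : ∀ {G : Graph n} → (∀ v → inV G v ≡ true) → ∀ {i j} → i ≤ j →
    (∀ {x} → i ≤ x → x < j → inE G (x mod n) (suc x mod n) ≡ true) → Walk G (i mod n) (j mod n) (j ∸ i)
  walk-mod {G} inV {i} {j} i≤j edge =
    subst (λ q → Walk G (i mod n) (q mod n) (j ∸ i)) (m+[n∸m]≡n i≤j)
      (walk-along (_mod n) (λ x → inV (x mod n)) i (j ∸ i)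
        λ {x} i≤x x<i+[j∸i] → edge i≤x (subst (x <_) (m+[n∸m]≡n i≤j) x<i+[j∸i]))

  cycle-step : ∀ x → inE (Cycle n) (x mod n) (suc x mod n) ≡ true
  cycle-step x = ∨-introˡ-true _ (succ⇒nextOf (x mod n) (suc x mod n)
    (trans (toℕ-mod (suc x)) (trans (%-suc x) (cong (λ z → suc z % n) (sym (toℕ-mod x))))))

  cycle-coloring⇒sequence : ∀ {s k} → PackingColorable (Cycle n) s k →
    Σ[ f ∈ (ℕ → ℕ) ] (∀ i → 1 ≤ f i × f i ≤ k) × PackedWithin s n f × (∀ p → f (p + n) ≡ f p)
  cycle-coloring⇒sequence {s} (φ , colors , apart) =
    (λ i → φ (i mod n)) , (λ i → colors (i mod n) refl) , packed , periodic
    where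
    periodic : ∀ p → φ ((p + n) mod n) ≡ φ (p mod n)
    periodic p = cong φ (toℕ-injective
      (trans (toℕ-mod (p + n)) (trans ([m+n]%n≡m%n p n) (sym (toℕ-mod p)))))
    packed : PackedWithin s n (λ i → φ (i mod n))
    packed {p} {q} p<q q<p+n eq =
      apart (p mod n) (q mod n) refl refl
        (λ p≡q → %-distinct p<q q<p+n (trans (sym (toℕ-mod p)) (trans (cong toℕ p≡q) (toℕ-mod q))))
        eq (q ∸ p) (walk-mod (λ _ → refl) (<⇒≤ p<q) (λ _ _ → cycle-step _))

  path-coloring⇒packing : ∀ {s k} → PackingColorable (PathGraph n) s k →
    Σ[ f ∈ (ℕ → ℕ) ] Palette k n f × PathPacking s n f
  path-coloring⇒packing {s} (φ , colors , apart) =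
    (λ i → φ (i mod n)) , (λ _ → colors _ refl) , packedBy packed
    where
    toℕ-mod-< : ∀ {i} → i < n → toℕ (i mod n) ≡ i
    toℕ-mod-< {i} i<n = trans (toℕ-mod i) (m<n⇒m%n≡m i<n)
    packed : ∀ {j} → j < n → ∀ {i} → i < j → φ (i mod n) ≡ φ (j mod n) → s (φ (i mod n)) < j ∸ i
    packed {j} j<n {i} i<j eq =
      apart (i mod n) (j mod n) refl refl
        (λ i≡j → <-irrefl (trans (sym (toℕ-mod-< (<-trans i<j j<n))) (trans (cong toℕ i≡j) (toℕ-mod-< j<n)))
                          i<j)
        eq (j ∸ i)
        (walk-mod (λ _ → refl) (<⇒≤ i<j) λ {x} _ x<j → ∨-introˡ-true _
          (≡⇒≡ᵇ-true (trans (cong suc (toℕ-mod-< (<-trans x<j j<n)))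
                            (sym (toℕ-mod-< (≤-<-trans x<j j<n))))))

pathGraph-proper : ∀ m → ProperSubgraph (PathGraph (3 + m)) (Cycle (3 + m))
pathGraph-proper m = record { V⊆ = λ _ _ → refl ; E⊆ = E⊆ ; E-sym = E-sym ; E-ends = λ _ _ _ → refl } ,
  inj₂ (fromℕ (2 + m) , zero , ∨-introˡ-true _ wrap , refl)
  where
  n = 3 + m
  E⊆ : ∀ x y → inE (PathGraph n) x y ≡ true → inE (Cycle n) x y ≡ true
  E⊆ x y e with ∨-elim-true (suc (toℕ x) ≡ᵇ toℕ y) e
  ... | inj₁ xy = ∨-introˡ-true _ (∨-introˡ-true _ xy)
  ... | inj₂ yx = ∨-introʳ-true (nextOf n x y) (∨-introˡ-true _ yx)
  E-sym : ∀ x y → inE (PathGraph n) x y ≡ inE (PathGraph n) y x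
  E-sym x y = ∨-comm (suc (toℕ x) ≡ᵇ toℕ y) (suc (toℕ y) ≡ᵇ toℕ x)
  wrap : nextOf n (fromℕ (2 + m)) zero ≡ true
  wrap = succ⇒nextOf (fromℕ (2 + m)) zero
    (sym (trans (cong (λ z → suc z % n) (toℕ-fromℕ (2 + m))) (n%n≡0 n)))

composition⇒cycle-colorable : ∀ {d s n} .{{_ : NonZero n}} → 4 ≤ d → s ≤[ 4 ] upper d →
  Composition (suc d) 8 n → PackingColorable (Cycle n) s 4
composition⇒cycle-colorable {d} {s} {n} 4≤d s≤upper (gs , bounds , total) =
  cycle-colorable palette (packedBy-antitone palette s≤upper cyclic)
  where
  w = concat (map block gs)
  |w|≡n : length w ≡ n
  |w|≡n = trans (blocks-length 4≤d bounds) total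
  palette : Palette 4 n (at w)
  palette = subst (λ N → Palette 4 N (at w)) |w|≡n (blocks-palette 4≤d gs)
  doubled-word : concat (map block (gs ++ gs)) ≡ w ++ w
  doubled-word = trans (cong concat (map-++ block gs gs)) (sym (concat-++ (map block gs) (map block gs)))
  doubled : PathPacking (upper d) (n + n) (at (w ++ w))
  doubled = subst (λ u → PathPacking (upper d) (n + n) (at u)) doubled-word
    (subst (λ N → PathPacking (upper d) N (at (concat (map block (gs ++ gs)))))
      (trans (blocks-length 4≤d (++⁺ bounds bounds)) (trans (sum-++ gs gs) (cong₂ _+_ total total)))
      (blocks-packing 4≤d (++⁺ bounds bounds)))
  cyclic : CyclePacking (upper d) n (at w)
  cyclic = cyclePacking-doubled w |w|≡n doubled

module _ {m : ℕ} {G : Graph m} {s : ℕ → ℕ} where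

  subgraph-colorable : ∀ {H k} → IsSubgraph H G → PackingColorable G s k → PackingColorable H s k
  subgraph-colorable sub (φ , colors , apart) =
    φ , (λ v v∈H → colors v (IsSubgraph.V⊆ sub v v∈H)) ,
    λ u v u∈H v∈H u≢v eq ℓ w →
      apart u v (IsSubgraph.V⊆ sub u u∈H) (IsSubgraph.V⊆ sub v v∈H) u≢v eq ℓ (walk-mono w)
    where
    walk-mono : ∀ {u v ℓ} → Walk _ u v ℓ → Walk G u v ℓ
    walk-mono (nil u∈H) = nil (IsSubgraph.V⊆ sub _ u∈H)
    walk-mono (cons e w) = cons (IsSubgraph.E⊆ sub _ _ e) (walk-mono w)

  colorable-mono : ∀ {j k} → j ≤ k → PackingColorable G s j → PackingColorable G s k
  colorable-mono j≤k (φ , colors , apart) =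
    φ , (λ v v∈G → proj₁ (colors v v∈G) , ≤-trans (proj₂ (colors v v∈G)) j≤k) , apart

  chromatic : ∀ {k} → PackingColorable G s (suc k) → ¬ PackingColorable G s k → IsChiS G s (suc k)
  chromatic colorable ¬colorable =
    colorable , λ j j<1+k → ¬colorable ∘ colorable-mono (s≤s⁻¹ j<1+k)

  chromatic-≤ : ∀ {a k} → IsChiS G s a → PackingColorable G s k → a ≤ k
  chromatic-≤ {a} {k} (_ , minimal) colorable with a ≤? k
  ... | yes a≤k = a≤k
  ... | no a≰k = ⊥-elim (minimal k (≰⇒> a≰k) colorable)

  chromatic-> : ∀ {b k} → IsChiS G s b → ¬ PackingColorable G s k → k < b
  chromatic-> {b} {k} (colorable , _) ¬colorable with k <? b
  ... | yes k<b = k<b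
  ... | no k≮b = ⊥-elim (¬colorable (colorable-mono (≮⇒≥ k≮b) colorable))

module _ {m : ℕ} {s : ℕ → ℕ} {k : ℕ} where

  private
    n = 3 + m

  critical⇔¬colorable : (Σ[ f ∈ (ℕ → ℕ) ] Palette (suc k) n f × PathPacking s n f) → NoPacking s k n →
    IsChiSCritical (Cycle n) s ⇔ (¬ PackingColorable (Cycle n) s (suc k))
  critical⇔¬colorable (f , pal , packed) none = mk⇔ only-if if
    where
    proper-colorable : ∀ {H} → ProperSubgraph H (Cycle n) → PackingColorable H s (suc k)
    proper-colorable H⊂C = properSubgraph-colorable H⊂C pal packed
    ¬path-colorable : ¬ PackingColorable (PathGraph n) s k
    ¬path-colorable c = let g , palette , packing = path-coloring⇒packing c in none g palette packing
    if : ¬ PackingColorable (Cycle n) s (suc k) → IsChiSCritical (Cycle n) s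
    if ¬c H H⊂C a b χH χC =
      ≤-<-trans (chromatic-≤ {G = H} {s} χH (proper-colorable H⊂C)) (chromatic-> {G = Cycle n} {s} χC ¬c)
    only-if : IsChiSCritical (Cycle n) s → ¬ PackingColorable (Cycle n) s (suc k)
    only-if critical c = <-irrefl refl (critical (PathGraph n) (pathGraph-proper m) (suc k) (suc k)
      (chromatic {G = PathGraph n} {s} (proper-colorable (pathGraph-proper m)) ¬path-colorable)
      (chromatic {G = Cycle n} {s} c
        (¬path-colorable ∘ subgraph-colorable {s = s} (proj₁ (pathGraph-proper m)))))

CriticalLength : ℕ → ℕ → Set
CriticalLength d n = (n ≢ 4 × n < 8) ⊎ (8 ≤ n × ¬ Composition (suc d) 8 n)

module Classification (s : ℕ → ℕ) (s₁ : s 1 ≡ 1) (s₂ : s 2 ≡ 2) (4≤s₃ : 4 ≤ s 3) (s₃≤s₄ : s 3 ≤ s 4)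
  (s₄≤7 : s 4 ≤ 7) where

  none₁ : NoPacking s 1 2
  none₁ = noPacking-double noPacking-zero (≤-reflexive (sym s₁))

  none₂ : NoPacking s 2 4
  none₂ = noPacking-double none₁ (≤-reflexive (sym s₂))

  none₃ : NoPacking s 3 8
  none₃ = noPacking-double none₂ 4≤s₃

  s≤upper : ∀ {d} → s 3 ≤ d → s 4 ≤ d → s ≤[ 4 ] upper d
  s≤upper _ _ {1} _ _ = ≤-reflexive s₁
  s≤upper _ _ {2} _ _ = ≤-reflexive s₂
  s≤upper s₃≤d _ {3} _ _ = s₃≤d
  s≤upper _ s₄≤d {4} _ _ = s₄≤d
  s≤upper _ _ {suc (suc (suc (suc (suc _))))} _ (s≤s (s≤s (s≤s (s≤s ()))))

  path-sequence : ∀ {k N} a → k ≤ 4 → N ≤ a * 8 → Palette k N (ruler a) →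
    Σ[ f ∈ (ℕ → ℕ) ] Palette k N f × PathPacking s N f
  path-sequence a k≤4 N≤ palette = ruler a , palette ,
    packedBy-antitone palette (λ 1≤c c≤k → s≤upper (≤-trans s₃≤s₄ s₄≤7) s₄≤7 1≤c (≤-trans c≤k k≤4))
      (packedBy-≤ N≤ (ruler-packing a))

  cycle-coloring⇒composition : ∀ {n k w} .{{_ : NonZero n}} → NoPacking s k w → w < n →
    PackingColorable (Cycle n) s (suc k) → Composition (suc (s (suc k))) w n
  cycle-coloring⇒composition none w<n c =
    let f , colors , packed , periodic = cycle-coloring⇒sequence {s = s} c in
    Gaps.cycle-composition none w<n colors packed periodic

  ¬cycle-colorable : ∀ {n k w} .{{_ : NonZero n}} → NoPacking s k w → w < n → w ≤ s (suc k) →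
    ¬ PackingColorable (Cycle n) s (suc k)
  ¬cycle-colorable none w<n w≤s c =
    <-irrefl (sym (composition-empty (s≤s w≤s) (cycle-coloring⇒composition none w<n c))) (≤-<-trans z≤n w<n)

  critical-3 : IsChiSCritical (Cycle 3) s
  critical-3 = Equivalence.from (critical⇔¬colorable {m = 0}
      (path-sequence 1 (≤ᵇ⇒≤ 2 4 _) (≤ᵇ⇒≤ 3 8 _) (toWitness {a? = palette? 2 3 (ruler 1)} _))
      (noPacking-mono (n≤1+n 2) none₁))
    (¬cycle-colorable none₁ ≤-refl (≤-reflexive (sym s₂)))

  ¬critical-4 : ¬ IsChiSCritical (Cycle 4) s
  ¬critical-4 critical = Equivalence.to (critical⇔¬colorable {m = 1}
      (path-sequence 1 (≤ᵇ⇒≤ 3 4 _) (≤ᵇ⇒≤ 4 8 _) (toWitness {a? = palette? 3 4 (ruler 1)} _))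
      none₂)
    critical
    (cycle-colorable palette
      (packedBy-antitone palette (λ 1≤c c≤3 → s≤upper (≤-trans s₃≤s₄ s₄≤7) s₄≤7 1≤c (m≤n⇒m≤1+n c≤3))
        (toWitness {a? = packedBy? (cycleDist 4) (upper 7) 4 word} _)))
    where
    -- colors 2 and 3 occur once, so s₃ is irrelevant
    word = at (1 ∷ 2 ∷ 1 ∷ 3 ∷ [])
    palette : Palette 3 4 word
    palette = toWitness {a? = palette? 3 4 word} _

  critical-5…7 : ∀ m → m ≤ 2 → IsChiSCritical (Cycle (5 + m)) s
  critical-5…7 m m≤2 = Equivalence.from (critical⇔¬colorable {m = 2 + m}
      (path-sequence 1 (≤ᵇ⇒≤ 3 4 _) (m≤n⇒m≤1+n n≤7)
        (palette-≤ n≤7 (toWitness {a? = palette? 3 7 (ruler 1)} _)))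
      (noPacking-mono (m≤m+n 4 (suc m)) none₂))
    (¬cycle-colorable none₂ (s≤s (m≤m+n 4 m)) 4≤s₃)
    where
    n≤7 : 5 + m ≤ 7
    n≤7 = +-monoʳ-≤ 5 m≤2

  colorable⇔composition : ∀ m → PackingColorable (Cycle (8 + m)) s 4 ⇔ Composition (suc (s 4)) 8 (8 + m)
  colorable⇔composition zero = mk⇔ (const (8 ∷ [] , (s≤s s₄≤7 , ≤-refl) ∷ [] , refl))
    (composition⇒cycle-colorable (≤-trans 4≤s₃ s₃≤s₄) (s≤upper s₃≤s₄ ≤-refl))
  colorable⇔composition (suc m) = mk⇔ (cycle-coloring⇒composition none₃ (m≤m+n 9 m))
    (composition⇒cycle-colorable (≤-trans 4≤s₃ s₃≤s₄) (s≤upper s₃≤s₄ ≤-refl))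

  critical⇔¬composition : ∀ m → IsChiSCritical (Cycle (8 + m)) s ⇔ (¬ Composition (suc (s 4)) 8 (8 + m))
  critical⇔¬composition m = ¬-cong-⇔ (colorable⇔composition m) ⇔-∘ critical⇔¬colorable {m = 5 + m} path none
    where
    n≤8n = m≤m*n (8 + m) 8
    path = path-sequence (8 + m) ≤-refl n≤8n (palette-≤ n≤8n (ruler-palette (8 + m)))
    none = noPacking-mono (m≤m+n 8 m) none₃

  classification : ∀ n → 3 ≤ n → IsChiSCritical (Cycle n) s ⇔ CriticalLength (s 4) n
  classification 1 (s≤s ())
  classification 2 (s≤s (s≤s ()))
  classification 3 _ = mk⇔ (const (inj₁ ((λ ()) , ≤ᵇ⇒≤ 4 8 _))) (const critical-3)
  classification 4 _ = mk⇔ (⊥-elim ∘ ¬critical-4) λ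
    { (inj₁ (4≢4 , _)) → ⊥-elim (4≢4 refl)
    ; (inj₂ (8≤4 , _)) → ⊥-elim (≤⇒≯ 8≤4 (≤ᵇ⇒≤ 5 8 _)) }
  classification 5 _ = mk⇔ (const (inj₁ ((λ ()) , ≤ᵇ⇒≤ 6 8 _))) (const (critical-5…7 0 z≤n))
  classification 6 _ = mk⇔ (const (inj₁ ((λ ()) , ≤ᵇ⇒≤ 7 8 _))) (const (critical-5…7 1 (s≤s z≤n)))
  classification 7 _ = mk⇔ (const (inj₁ ((λ ()) , ≤-refl))) (const (critical-5…7 2 (s≤s (s≤s z≤n))))
  classification (suc (suc (suc (suc (suc (suc (suc (suc m)))))))) _ =
    mk⇔ (λ critical → inj₂ (m≤m+n 8 m , Equivalence.to (critical⇔¬composition m) critical)) λ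
      { (inj₁ (_ , n<8)) → ⊥-elim (m+n≮m 8 m n<8)
      ; (inj₂ (_ , ¬composition)) → Equivalence.from (critical⇔¬composition m) ¬composition }

classify : ∀ {d} → d ≤ 7 → (s : ℕ → ℕ) → s 1 ≡ 1 → s 2 ≡ 2 → 4 ≤ s 3 → s 3 ≤ d → s 4 ≡ d →
  ∀ n → 3 ≤ n → IsChiSCritical (Cycle n) s ⇔ CriticalLength d n
classify d≤7 s s₁ s₂ 4≤s₃ s₃≤d refl = Classification.classification s s₁ s₂ 4≤s₃ s₃≤d d≤7

module _ {d : ℕ} (d≤7 : d ≤ 7) where

  private
    composable? : ∀ n → Dec (Composition (suc d) 8 n)
    composable? = composition? (s≤s z≤n) (s≤s d≤7)

  criticalLength? : ∀ n → Dec (CriticalLength d n)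
  criticalLength? n = (¬? (n ≟ 4) ×-dec n <? 8) ⊎-dec (8 ≤? n ×-dec ¬? (composable? n))

  -- Every n ≥ 42 is a sum of 7s and 8s (41 is not), hence of parts in [d + 1, 8] for d ≤ 6.
  critical-lengths : (L : List ℕ) →
    (∀ {n} → n < 42 → 3 ≤ n → (CriticalLength d n → n ∈ L) × (n ∈ L → CriticalLength d n)) →
    (∀ {n} → n < 50 → 42 ≤ n → Composition (suc d) 8 n) →
    All (_< 42) L →
    ∀ n → 3 ≤ n → CriticalLength d n ⇔ n ∈ L
  critical-lengths L small large bounded n 3≤n with n <? 42
  ... | yes n<42 = let if , only-if = small n<42 3≤n in mk⇔ if only-if
  ... | no n≮42 = mk⇔ (⊥-elim ∘ ¬critical) (⊥-elim ∘ n≮42 ∘ All.lookup bounded)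
    where
    composable : Composition (suc d) 8 n
    composable = composition-eventually (s≤s z≤n) (s≤s d≤7)
      (λ 42≤k k<42+a → large (<-≤-trans k<42+a (+-monoʳ-≤ 42 (s≤s d≤7))) 42≤k) n (≮⇒≥ n≮42)
    ¬critical : ¬ CriticalLength d n
    ¬critical (inj₁ (_ , n<8)) = n≮42 (<-trans n<8 (≤ᵇ⇒≤ 9 42 _))
    ¬critical (inj₂ (_ , ¬composable)) = ¬composable composable

  critical-lengths-computed : (L : List ℕ) →
    True (allUpTo? (λ n → 3 ≤? n →-dec
      ((criticalLength? n →-dec n ∈? L) ×-dec (n ∈? L →-dec criticalLength? n))) 42) →
    True (allUpTo? (λ n → 42 ≤? n →-dec composable? n) 50) →
    True (all? (_<? 42) L) →
    ∀ n → 3 ≤ n → CriticalLength d n ⇔ n ∈ L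
  critical-lengths-computed L small large bounded =
    critical-lengths L (toWitness small) (toWitness large) (toWitness bounded)

lengths₄ : ∀ n → 3 ≤ n → CriticalLength 4 n ⇔ n ∈ 3 ∷ 5 ∷ 6 ∷ 7 ∷ 9 ∷ []
lengths₄ = critical-lengths-computed (≤ᵇ⇒≤ 4 7 _) _ _ _ _

lengths₅ : ∀ n → 3 ≤ n → CriticalLength 5 n ⇔ n ∈ 3 ∷ 5 ∷ 6 ∷ 7 ∷ 9 ∷ 10 ∷ 11 ∷ 17 ∷ []
lengths₅ = critical-lengths-computed (≤ᵇ⇒≤ 5 7 _) _ _ _ _

lengths₆ : ∀ n → 3 ≤ n → CriticalLength 6 n ⇔
  n ∈ 3 ∷ 5 ∷ 6 ∷ 7 ∷ 9 ∷ 10 ∷ 11 ∷ 12 ∷ 13 ∷ 17 ∷ 18 ∷ 19 ∷ 20 ∷ 25 ∷ 26 ∷ 27 ∷ 33 ∷ 34 ∷ 41 ∷ []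
lengths₆ = critical-lengths-computed (≤ᵇ⇒≤ 6 7 _) _ _ _ _

theorem4p1 : (n : ℕ) → 3 ≤ n → (s : ℕ → ℕ) → IsPackingSeq s →
    (S-1-2-4-4 s → (IsChiSCritical (Cycle n) s ⇔ (n ∈ 3 ∷ 5 ∷ 6 ∷ 7 ∷ 9 ∷ []))) ×
    (S-1-2-4bar-5 s → (IsChiSCritical (Cycle n) s ⇔ (n ∈ 3 ∷ 5 ∷ 6 ∷ 7 ∷ 9 ∷ 10 ∷ 11 ∷ 17 ∷ []))) ×
    (S-1-2-4bar-6 s → (IsChiSCritical (Cycle n) s ⇔
      (n ∈ 3 ∷ 5 ∷ 6 ∷ 7 ∷ 9 ∷ 10 ∷ 11 ∷ 12 ∷ 13 ∷ 17 ∷ 18 ∷ 19 ∷ 20 ∷ 25 ∷ 26 ∷ 27 ∷ 33 ∷ 34 ∷ 41 ∷ [])))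
theorem4p1 n 3≤n s _ =
  (λ (s₁ , s₂ , s₃ , s₄) →
    lengths₄ n 3≤n ⇔-∘ classify (≤ᵇ⇒≤ 4 7 _) s s₁ s₂ (≤-reflexive (sym s₃)) (≤-reflexive s₃) s₄ n 3≤n) ,
  (λ (s₁ , s₂ , 4≤s₃ , s₃≤5 , s₄) → lengths₅ n 3≤n ⇔-∘ classify (≤ᵇ⇒≤ 5 7 _) s s₁ s₂ 4≤s₃ s₃≤5 s₄ n 3≤n) ,
  (λ (s₁ , s₂ , 4≤s₃ , s₃≤6 , s₄) → lengths₆ n 3≤n ⇔-∘ classify (≤ᵇ⇒≤ 6 7 _) s s₁ s₂ 4≤s₃ s₃≤6 s₄ n 3≤n)
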